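{- Let $R$ be a finite ring with unity (multiplication not assumed associative) and let $(a,b)\in{}^2\!R$ be unimodular. If there exists $\alpha\in R$ such that $(\alpha a,\alpha b)$ is not unimodular and $R(\alpha a,\alpha b)$ is a free cyclic submodule of ${}^2\!R$, then $R$ is non-associative.
   Context: ${}^2\!R$ denotes $R\times R$ with left multiplication $\beta(a,b)=(\beta a,\beta b)$. For $(c,d)\in{}^2\!R$, $R(c,d)=\{(\beta c,\beta d):\beta\in R\}$, called a free cyclic submodule if $(\beta c,\beta d)=(0,0)$ implies $\beta=0$. $(c,d)$ is unimodular if $cR+dR=\{cx+dy:x,y\in R\}=R$. -}

module Defs where

open import Level using (Level; _⊔_)
open import Data.Nat using (ℕ)
open import Data.Fin using (Fin)
open import Data.Product using (Σ; ∃; ∃-syntax; _×_)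
open import Relation.Nullary using (¬_)
open import Relation.Binary.PropositionalEquality using () renaming (setoid to ≡-setoid)
open import Function.Bundles using (Inverse)
open import Algebra.Bundles using (NonAssociativeRing)

module _ {c ℓ : Level} (R : NonAssociativeRing c ℓ) where
  open NonAssociativeRing R

  IsFinite : Set (c ⊔ ℓ)
  IsFinite = ∃[ n ] Inverse (≡-setoid (Fin n)) setoid

  Unimodular : Carrier → Carrier → Set (c ⊔ ℓ)
  Unimodular x y = ∀ r → ∃[ s ] ∃[ t ] ((x * s) + (y * t) ≈ r)

  FreeCyclic : Carrier → Carrier → Set (c ⊔ ℓ)
  FreeCyclic x y = ∀ β → β * x ≈ 0# → β * y ≈ 0# → β ≈ 0#

  IsAssociative : Set (c ⊔ ℓ)
  IsAssociative = ∀ x y z → (x * y) * z ≈ x * (y * z)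

module Submission where

-- Suppose, for a contradiction, that R is associative.  Then
--   (1) freeness of R(αa, αb) makes α right-cancellable: from x·α = y·α we
--       get (x - y)·(αa) = 0 = (x - y)·(αb), hence x = y;
--   (2) in a finite set an injective self-map is surjective, so right
--       multiplication by α hits 1: there is γ with γ·α = 1;
--   (3) such a γ makes α left-cancellable, so by (2) again left
--       multiplication by α is surjective;
--   (4) if α·_ is surjective, unimodularity of (a, b) passes to (αa, αb):
--       with a·s + b·t = 1 and α·x = r we get αa·(s·x) + αb·(t·x) = r.
-- This contradicts the hypothesis that (αa, αb) is not unimodular.

open import Defs
open import Level using (Level)
open import Data.Product using (∃-syntax; _×_; _,_; ∃; proj₁; proj₂)
open import Relation.Nullary using (¬_; yes; no)
open import Algebra.Bundles using (NonAssociativeRing; Ring)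
open import Algebra.Structures using (module IsNonAssociativeRing)
open import Data.Nat using (zero; suc)
open import Data.Nat.Properties using (n≮n)
open import Data.Fin using (Fin; punchOut)
open import Data.Fin.Properties using (any?; _≟_; punchOut-injective; injective⇒≤)
open import Data.Empty using (⊥; ⊥-elim)
open import Function.Bundles using (Inverse)
open import Relation.Binary.Bundles using (Setoid)
open import Relation.Binary.PropositionalEquality as ≡ using (_≡_)
import Algebra.Properties.RingWithoutOne as RingWithoutOneProperties
import Algebra.Properties.Group as GroupProperties
import Relation.Binary.Reasoning.Setoid as SetoidReasoning

-- Pigeonhole: an injective map Fin n → Fin n is surjective.  If y were
-- missed, punching y out would give an injection Fin (suc m) → Fin m.
fin-injective⇒surjective : ∀ {n} (f : Fin n → Fin n) →
  (∀ {i j} → f i ≡ f j → i ≡ j) → ∀ y → ∃ λ x → f x ≡ y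
fin-injective⇒surjective {zero}  f f-inj ()
fin-injective⇒surjective {suc m} f f-inj y with any? (λ x → f x ≟ y)
... | yes hit = hit
... | no miss = ⊥-elim (n≮n m (injective⇒≤ {f = g} g-inj))
  where
  f≢y : ∀ x → y ≡ f x → ⊥
  f≢y x e = miss (x , ≡.sym e)

  g : Fin (suc m) → Fin m
  g x = punchOut (f≢y x)

  g-inj : ∀ {i j} → g i ≡ g j → i ≡ j
  g-inj {i} {j} e = f-inj (punchOut-injective (f≢y i) (f≢y j) e)

module _ {c ℓ} (S : Setoid c ℓ) where
  open Setoid S

  finite-injective⇒surjective : ∀ {n} → Inverse (≡.setoid (Fin n)) S →
    (h : Carrier → Carrier) → (∀ {x y} → h x ≈ h y → x ≈ y) →
    ∀ y → ∃ λ x → h x ≈ y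
  finite-injective⇒surjective {n} I h h-inj y = to i , (begin
      h (to i)    ≈⟨ to∘from (h (to i)) ⟨
      to (F i)    ≈⟨ to-cong Fi≡from-y ⟩
      to (from y) ≈⟨ to∘from y ⟩
      y           ∎)
    where
    open Inverse I
    open SetoidReasoning S

    to∘from : ∀ x → to (from x) ≈ x
    to∘from x = inverseˡ ≡.refl

    F : Fin n → Fin n
    F i = from (h (to i))

    from∘to : ∀ i → from (to i) ≡ i
    from∘to i = inverseʳ refl

    F-inj : ∀ {i j} → F i ≡ F j → i ≡ j
    F-inj {i} {j} e = ≡.trans (≡.sym (from∘to i))
      (≡.trans (from-cong (h-inj h[to-i]≈h[to-j])) (from∘to j))
      where
      h[to-i]≈h[to-j] : h (to i) ≈ h (to j)
      h[to-i]≈h[to-j] = begin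
        h (to i) ≈⟨ to∘from (h (to i)) ⟨
        to (F i) ≈⟨ to-cong e ⟩
        to (F j) ≈⟨ to∘from (h (to j)) ⟩
        h (to j) ∎

    i : Fin n
    i = proj₁ (fin-injective⇒surjective F F-inj (from y))

    Fi≡from-y : F i ≡ from y
    Fi≡from-y = proj₂ (fin-injective⇒surjective F F-inj (from y))

module AssociativeRing {c ℓ} (R : NonAssociativeRing c ℓ) (assoc : IsAssociative R) where
  open NonAssociativeRing R
  open SetoidReasoning setoid

  ring : Ring c ℓ
  ring = record { isRing = record
    { +-isAbelianGroup = IsNonAssociativeRing.+-isAbelianGroup isNonAssociativeRing
    ; *-cong           = IsNonAssociativeRing.*-cong isNonAssociativeRing
    ; *-assoc          = assoc
    ; *-identity       = IsNonAssociativeRing.*-identity isNonAssociativeRing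
    ; distrib          = IsNonAssociativeRing.distrib isNonAssociativeRing
    } }

  open RingWithoutOneProperties (Ring.ringWithoutOne ring) using ([y-z]x≈yx-zx)
  open GroupProperties +-group using (x∙y⁻¹≈ε⇒x≈y; x≈y⇒x∙y⁻¹≈ε)

  -- Step (1): if R(αa, αb) is a free cyclic submodule, then α is
  -- right-cancellable, since (x - y)·α = 0 forces (x - y) to annihilate
  -- both αa and αb.
  free⇒right-cancellable : ∀ α a b → FreeCyclic R (α * a) (α * b) →
    ∀ {x y} → x * α ≈ y * α → x ≈ y
  free⇒right-cancellable α a b free {x} {y} xα≈yα =
    x∙y⁻¹≈ε⇒x≈y x y (free (x - y) (kills a) (kills b))
    where
    [x-y]α≈0 : (x - y) * α ≈ 0#
    [x-y]α≈0 = trans ([y-z]x≈yx-zx α x y) (x≈y⇒x∙y⁻¹≈ε xα≈yα)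

    kills : ∀ z → (x - y) * (α * z) ≈ 0#
    kills z = begin
      (x - y) * (α * z) ≈⟨ assoc (x - y) α z ⟨
      ((x - y) * α) * z ≈⟨ *-congʳ [x-y]α≈0 ⟩
      0# * z            ≈⟨ zeroˡ z ⟩
      0#                ∎

  left-invertible⇒left-cancellable : ∀ {γ α} → γ * α ≈ 1# →
    ∀ {x y} → α * x ≈ α * y → x ≈ y
  left-invertible⇒left-cancellable {γ} {α} γα≈1 {x} {y} αx≈αy = begin
    x           ≈⟨ *-identityˡ x ⟨
    1# * x      ≈⟨ *-congʳ γα≈1 ⟨
    γ * α * x   ≈⟨ assoc γ α x ⟩
    γ * (α * x) ≈⟨ *-congˡ αx≈αy ⟩
    γ * (α * y) ≈⟨ assoc γ α y ⟨
    γ * α * y   ≈⟨ *-congʳ γα≈1 ⟩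
    1# * y      ≈⟨ *-identityˡ y ⟩
    y           ∎

  unimodular-preserved : ∀ {α a b} → (∀ r → ∃ λ x → α * x ≈ r) →
    Unimodular R a b → Unimodular R (α * a) (α * b)
  unimodular-preserved {α} {a} {b} α-onto unimodular r
    with s , t , as+bt≈1 ← unimodular 1#
       | x , αx≈r ← α-onto r
    = s * x , t * x , (begin
      α * a * (s * x) + α * b * (t * x)     ≈⟨ +-cong (regroup a s) (regroup b t) ⟩
      α * (a * s * x) + α * (b * t * x)     ≈⟨ distribˡ α _ _ ⟨
      α * (a * s * x + b * t * x)           ≈⟨ *-congˡ (distribʳ x _ _) ⟨
      α * ((a * s + b * t) * x)             ≈⟨ *-congˡ (*-congʳ as+bt≈1) ⟩
      α * (1# * x)                          ≈⟨ *-congˡ (*-identityˡ x) ⟩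
      α * x                                 ≈⟨ αx≈r ⟩
      r                                     ∎)
    where
    regroup : ∀ u v → α * u * (v * x) ≈ α * (u * v * x)
    regroup u v = trans (assoc α u (v * x)) (*-congˡ (sym (assoc u v x)))

mainTheorem10 : {c ℓ : Level} (R : NonAssociativeRing c ℓ) →
    IsFinite R →
    (a b : NonAssociativeRing.Carrier R) →
    Unimodular R a b →
    (∃[ α ] (¬ Unimodular R (NonAssociativeRing._*_ R α a) (NonAssociativeRing._*_ R α b)
             × FreeCyclic R (NonAssociativeRing._*_ R α a) (NonAssociativeRing._*_ R α b))) →
    ¬ IsAssociative R
mainTheorem10 R (_ , I) a b unimodular (α , not-unimodular , free) assoc =
  not-unimodular (unimodular-preserved α-onto unimodular)
  where
  open NonAssociativeRing R
  open AssociativeRing R assoc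

  left-inverse : ∃ λ γ → γ * α ≈ 1#
  left-inverse = finite-injective⇒surjective setoid I (_* α)
    (free⇒right-cancellable α a b free) 1#

  α-onto : ∀ r → ∃ λ x → α * x ≈ r
  α-onto = finite-injective⇒surjective setoid I (α *_)
    (left-invertible⇒left-cancellable (proj₂ left-inverse))
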